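{- Let $k$ be a positive integer, let $a_n=kn$ for $n\ge1$, and let $x_n=0.a_na_{n+1}a_{n+2}\dots$ be the real number whose decimal expansion after the decimal point is the concatenation of the decimal representations of $a_n,a_{n+1},a_{n+2},\dots$. Then $$A\left([0.1,0.2);\left\lfloor\frac{2\times10^J}{k}\right\rfloor;(x_n)_n\right)=\sum_{i=0}^{J}\left(\left\lfloor\frac{10^i}{k}\right\rfloor+O(1)\right),$$ that is, there is a constant $C$ (depending only on $k$) such that for every integer $J\ge0$ the left-hand side differs from $\sum_{i=0}^{J}\lfloor 10^i/k\rfloor$ by at most $C(J+1)$.
   Context: For a real number $x$, $\lfloor x\rfloor$ is its integer part and $\{x\}$ its fractional part. For a sequence of real numbers $(x_n)_n$, a set $E\subseteq[0,1]$ and a real $N\ge 1$, $A(E;N;(x_n)_n)$ denotes the number of indices $n$ with $1\le n\le N$ and $\{x_n\}\in E$. -}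

module Defs where

open import Data.Nat using (ℕ; zero; suc; _+_; _*_; _∸_; _^_; _≤_; NonZero)
open import Data.Nat.DivMod using (_/_; _%_)
open import Data.Nat.Properties using (_≟_)
open import Data.Bool using (if_then_else_)
open import Relation.Nullary.Decidable using (does)

-- number of decimal digits of m (with fuel); numDigits 0 = 1 by convention
-- (only used for m ≥ 1 below).
lenF : ℕ → ℕ → ℕ
lenF zero    m = 1
lenF (suc f) m with m / 10
... | zero  = 1
... | suc q = suc (lenF f (suc q))

numDigits : ℕ → ℕ
numDigits m = lenF m m

-- i-th decimal digit of m counted from the left (0-indexed), i < numDigits m
-- ⌊m / 10^j⌋
div10^ : ℕ → ℕ → ℕ
div10^ m zero    = m
div10^ m (suc j) = div10^ m j / 10

digitOf : ℕ → ℕ → ℕ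
digitOf m i = div10^ m (numDigits m ∸ suc i) % 10

a : ℕ → ℕ → ℕ
a k n = k * n

-- p-th digit (0-indexed) after the decimal point of
-- x_n = 0.a_n a_{n+1} a_{n+2} ...   (fuel argument; fuel p+1 suffices since
-- each a_m, m ≥ 1, contributes at least one digit)
concatDigitF : ℕ → ℕ → ℕ → ℕ → ℕ
concatDigitF zero    k n p = 0
concatDigitF (suc f) k n p with does (Data.Nat.Properties._<?_ p (numDigits (a k n)))
... | Data.Bool.true  = digitOf (a k n) p
... | Data.Bool.false = concatDigitF f k (suc n) (p ∸ numDigits (a k n))

xDigit : ℕ → ℕ → ℕ → ℕ
xDigit k n p = concatDigitF (suc p) k n p

-- {x_n} ∈ [0.1, 0.2) iff the first digit after the point of x_n is 1
-- (x_n's expansion never ends in all 9s nor all 0s)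
inE : ℕ → ℕ → Data.Bool.Bool
inE k n = does (xDigit k n 0 ≟ 1)

A : ℕ → ℕ → ℕ
A k zero    = 0
A k (suc N) = (if inE k (suc N) then 1 else 0) + A k N

S : (k : ℕ) → .{{NonZero k}} → ℕ → ℕ
S k zero    = 1 / k
S k (suc J) = 10 ^ suc J / k + S k J

{-# OPTIONS --safe #-}
module Submission where

-- The first digit of x_n is the leading digit of k n. As n runs through the block
-- (⌊2·10^J/k⌋, ⌊2·10^(J+1)/k⌋], the product k n runs through (2·10^J, 2·10^(J+1)],
-- and its leading digit is 1 exactly when 10^(J+1) ≤ k n < 2·10^(J+1). That happens
-- for ⌊10^(J+1)/k⌋ or ⌊10^(J+1)/k⌋ + 1 values of n, so each block adds ⌊10^(J+1)/k⌋
-- to the count up to an error of at most 1, and C = 1 works.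

open import Defs
open import Data.Bool using (true; false)
open import Data.Nat
open import Data.Nat.DivMod
open import Data.Nat.Properties
open import Data.Product using (Σ; _×_; _,_)
open import Relation.Binary.PropositionalEquality
open import Relation.Nullary using (contradiction)
open import Relation.Nullary.Decidable using (does; dec-true; dec-false)

module _ (k : ℕ) .{{_ : NonZero k}} where

  k*n≤m⇒n≤m/k : ∀ {m n} → k * n ≤ m → n ≤ m / k
  k*n≤m⇒n≤m/k {m} {n} kn≤m = begin
    n             ≡⟨ m*n/n≡m n k ⟨
    n * k / k     ≤⟨ /-monoˡ-≤ k (≤-trans (≤-reflexive (*-comm n k)) kn≤m) ⟩
    m / k         ∎
    where open ≤-Reasoning

  n≤m/k⇒k*n≤m : ∀ {m n} → n ≤ m / k → k * n ≤ m
  n≤m/k⇒k*n≤m {m} {n} n≤m/k = begin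
    k * n         ≤⟨ *-monoʳ-≤ k n≤m/k ⟩
    k * (m / k)   ≡⟨ *-comm k (m / k) ⟩
    m / k * k     ≤⟨ m/n*n≤m m k ⟩
    m             ∎
    where open ≤-Reasoning

  m<k*n⇒m/k<n : ∀ {m n} → m < k * n → m / k < n
  m<k*n⇒m/k<n m<kn = ≰⇒> (λ n≤m/k → <⇒≱ m<kn (n≤m/k⇒k*n≤m n≤m/k))

  m/k<n⇒m<k*n : ∀ {m n} → m / k < n → m < k * n
  m/k<n⇒m<k*n m/k<n = ≰⇒> (λ kn≤m → <⇒≱ m/k<n (k*n≤m⇒n≤m/k kn≤m))

  n≤pred[m]/k⇒k*n<m : ∀ {m n} → .{{NonZero m}} → n ≤ pred m / k → k * n < m
  n≤pred[m]/k⇒k*n<m n≤pred[m]/k = m≤pred[n]⇒suc[m]≤n (n≤m/k⇒k*n≤m n≤pred[m]/k)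

  pred[m]/k<n⇒m≤k*n : ∀ {m n} → pred m / k < n → m ≤ k * n
  pred[m]/k<n⇒m≤k*n {m} pred[m]/k<n with m | m/k<n⇒m<k*n pred[m]/k<n
  ... | zero  | _       = z≤n
  ... | suc _ | m′<k*n = m′<k*n

  m/k+n/k≤[m+n]/k : ∀ m n → m / k + n / k ≤ (m + n) / k
  m/k+n/k≤[m+n]/k m n = k*n≤m⇒n≤m/k (begin
    k * (m / k + n / k)        ≡⟨ *-distribˡ-+ k (m / k) (n / k) ⟩
    k * (m / k) + k * (n / k)  ≤⟨ +-mono-≤ (n≤m/k⇒k*n≤m ≤-refl) (n≤m/k⇒k*n≤m ≤-refl) ⟩
    m + n                      ∎)
    where open ≤-Reasoning

  [m+n]/k≤m/k+[1+n/k] : ∀ m n → (m + n) / k ≤ m / k + suc (n / k)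
  [m+n]/k≤m/k+[1+n/k] m n = ≤-pred (m<k*n⇒m/k<n (begin-strict
    m + n                              <⟨ +-mono-< (m/k<n⇒m<k*n (n<1+n (m / k))) (m/k<n⇒m<k*n (n<1+n (n / k))) ⟩
    k * suc (m / k) + k * suc (n / k)  ≡⟨ *-distribˡ-+ k (suc (m / k)) (suc (n / k)) ⟨
    k * (suc (m / k) + suc (n / k))    ∎))
    where open ≤-Reasoning

  [1+m]/k≤1+m/k : ∀ m → suc m / k ≤ suc (m / k)
  [1+m]/k≤1+m/k m = ≤-pred (m<k*n⇒m/k<n (begin-strict
    suc m                    ≤⟨ m/k<n⇒m<k*n (n<1+n (m / k)) ⟩
    k * suc (m / k)          <⟨ *-monoʳ-< k (n<1+n (suc (m / k))) ⟩
    k * suc (suc (m / k))    ∎))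
    where open ≤-Reasoning

pred[2*m]≡pred[m]+m : ∀ m .{{_ : NonZero m}} → pred (2 * m) ≡ pred m + m
pred[2*m]≡pred[m]+m (suc m) = cong (m +_) (+-identityʳ (suc m))

n<10^n : ∀ n → n < 10 ^ n
n<10^n zero    = z<s
n<10^n (suc n) = ≤-<-trans (n<10^n n) (^-monoʳ-< 10 (s<s z<s) (n<1+n n))

lenF≡1+d : ∀ f d m → 10 ^ d ≤ m → m < 10 ^ suc d → d ≤ f → lenF f m ≡ suc d
lenF≡1+d zero    zero    m _  _  _ = refl
lenF≡1+d (suc f) zero    m _  hi _ with m / 10 | m<k*n⇒m/k<n 10 {n = 1} hi
... | zero  | _       = refl
... | suc _ | s<s ()
lenF≡1+d (suc f) (suc d) m lo hi (s≤s d≤f) with m / 10 | k*n≤m⇒n≤m/k 10 lo | m<k*n⇒m/k<n 10 hi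
... | zero  | 10^d≤0 | _   = contradiction 10^d≤0 (<⇒≱ (m^n>0 10 d))
... | suc q | lo′    | hi′ = cong suc (lenF≡1+d f d (suc q) lo′ hi′ d≤f)

numDigits≡1+d : ∀ {d m} → 10 ^ d ≤ m → m < 10 ^ suc d → numDigits m ≡ suc d
numDigits≡1+d {d} {m} lo hi = lenF≡1+d m d m lo hi (<⇒≤ (<-≤-trans (n<10^n d) lo))

div10^≡/10^ : ∀ m d .{{_ : NonZero (10 ^ d)}} → div10^ m d ≡ m / 10 ^ d
div10^≡/10^ m zero    = sym (n/1≡n m)
div10^≡/10^ m (suc d) = begin
  div10^ m d / 10     ≡⟨ /-congˡ (div10^≡/10^ m d) ⟩
  m / 10 ^ d / 10     ≡⟨ m/n/o≡m/[n*o] m (10 ^ d) 10 ⟩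
  m / (10 ^ d * 10)   ≡⟨ /-congʳ (*-comm (10 ^ d) 10) ⟩
  m / 10 ^ suc d      ∎
  where
  open ≡-Reasoning
  instance
    10^d≢0 : NonZero (10 ^ d)
    10^d≢0 = m^n≢0 10 d
    10^d*10≢0 : NonZero (10 ^ d * 10)
    10^d*10≢0 = m*n≢0 (10 ^ d) 10

2*10^d<10^[1+d] : ∀ d → 2 * 10 ^ d < 10 ^ suc d
2*10^d<10^[1+d] d = *-monoˡ-< (10 ^ d) {{m^n≢0 10 d}} {2} {10} (s<s (s<s z<s))

module _ {d : ℕ} where
  private instance
    10^d≢0 : NonZero (10 ^ d)
    10^d≢0 = m^n≢0 10 d

  leadingDigit≡/10^d : ∀ {m} → 10 ^ d ≤ m → m < 10 ^ suc d → digitOf m 0 ≡ m / 10 ^ d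
  leadingDigit≡/10^d {m} lo hi = begin
    div10^ m (numDigits m ∸ 1) % 10   ≡⟨ cong (λ l → div10^ m (l ∸ 1) % 10) (numDigits≡1+d {d} lo hi) ⟩
    div10^ m d % 10                   ≡⟨ cong (_% 10) (div10^≡/10^ m d) ⟩
    m / 10 ^ d % 10                   ≡⟨ m<n⇒m%n≡m (m<n*o⇒m/o<n {n = 10} hi) ⟩
    m / 10 ^ d                        ∎
    where open ≡-Reasoning

  leadingDigit≡1 : ∀ {m} → 10 ^ d ≤ m → m < 2 * 10 ^ d → digitOf m 0 ≡ 1
  leadingDigit≡1 lo hi = trans (leadingDigit≡/10^d lo (<-trans hi (2*10^d<10^[1+d] d)))
    (≤-antisym (≤-pred (m<n*o⇒m/o<n {n = 2} hi)) (m≥n⇒m/n>0 lo))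

  2≤leadingDigit : ∀ {m} → 2 * 10 ^ d ≤ m → m < 10 ^ suc d → 2 ≤ digitOf m 0
  2≤leadingDigit lo hi = subst (2 ≤_) (sym (leadingDigit≡/10^d (≤-trans (m≤n*m (10 ^ d) 2) lo) hi))
    (k*n≤m⇒n≤m/k (10 ^ d) (≤-trans (≤-reflexive (*-comm (10 ^ d) 2)) lo))

0<lenF : ∀ f m → 0 < lenF f m
0<lenF zero    m = z<s
0<lenF (suc f) m with m / 10
... | zero  = z<s
... | suc _ = z<s

-- Every a_m has at least one digit, so the first digit of x_n is the leading digit of a_n.
inE≡[leadingDigit≟1] : ∀ k n → inE k n ≡ does (digitOf (k * n) 0 ≟ 1)
inE≡[leadingDigit≟1] k n rewrite dec-true (0 <? numDigits (k * n)) (0<lenF (k * n) (k * n)) = refl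

inE-true : ∀ k n d → 10 ^ d ≤ k * n → k * n < 2 * 10 ^ d → inE k n ≡ true
inE-true k n d lo hi =
  trans (inE≡[leadingDigit≟1] k n) (dec-true (_ ≟ 1) (leadingDigit≡1 {d} lo hi))

inE-false : ∀ k n d → 2 * 10 ^ d ≤ k * n → k * n < 10 ^ suc d → inE k n ≡ false
inE-false k n d lo hi =
  trans (inE≡[leadingDigit≟1] k n)
    (dec-false (_ ≟ 1) (λ eq → <⇒≱ (subst (2 ≤_) eq (2≤leadingDigit {d} lo hi)) ≤-refl))

A≤N : ∀ k N → A k N ≤ N
A≤N k zero    = z≤n
A≤N k (suc N) with inE k (suc N)
... | true  = s≤s (A≤N k N)
... | false = m≤n⇒m≤1+n (A≤N k N)

module _ (k : ℕ) {N : ℕ} where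

  A-stable : ∀ {M} → N ≤′ M → (∀ {n} → N < n → n ≤ M → inE k n ≡ false) → A k M ≡ A k N
  A-stable ≤′-refl             _   = refl
  A-stable (≤′-step {M} N≤′M) off rewrite off (s≤s (≤′⇒≤ N≤′M)) ≤-refl =
    A-stable N≤′M (λ lo hi → off lo (m≤n⇒m≤1+n hi))

  A-grows : ∀ {M} → N ≤′ M → (∀ {n} → N < n → n ≤ M → inE k n ≡ true) → A k M ≡ (M ∸ N) + A k N
  A-grows ≤′-refl             _  rewrite n∸n≡0 N = refl
  A-grows (≤′-step {M} N≤′M) on rewrite on (s≤s (≤′⇒≤ N≤′M)) ≤-refl | +-∸-assoc 1 (≤′⇒≤ N≤′M) =
    cong suc (A-grows N≤′M (λ lo hi → on lo (m≤n⇒m≤1+n hi)))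

-- L and U are the largest n with k n < P and k n < 2 P, so the block (N, M] splits into
-- (N, L], (L, U], (U, M], on which the leading digit of k n is ≥ 2, 1, 2 respectively.
module Block (k : ℕ) .{{_ : NonZero k}} (J : ℕ) where
  P N L U M : ℕ
  P = 10 ^ suc J
  N = 2 * 10 ^ J / k
  L = pred P / k
  U = pred (2 * P) / k
  M = 2 * P / k

  private instance
    P≢0 : NonZero P
    P≢0 = m^n≢0 10 (suc J)
    2*P≢0 : NonZero (2 * P)
    2*P≢0 = m*n≢0 2 P

  inE-between-N-L : ∀ {n} → N < n → n ≤ L → inE k n ≡ false
  inE-between-N-L {n} lo hi = inE-false k n J (<⇒≤ (m/k<n⇒m<k*n k lo)) (n≤pred[m]/k⇒k*n<m k hi)

  inE-between-L-U : ∀ {n} → L < n → n ≤ U → inE k n ≡ true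
  inE-between-L-U {n} lo hi = inE-true k n (suc J) (pred[m]/k<n⇒m≤k*n k lo) (n≤pred[m]/k⇒k*n<m k hi)

  inE-between-U-M : ∀ {n} → U < n → n ≤ M → inE k n ≡ false
  inE-between-U-M {n} lo hi =
    inE-false k n (suc J) (pred[m]/k<n⇒m≤k*n k lo) (≤-<-trans (n≤m/k⇒k*n≤m k hi) (2*10^d<10^[1+d] (suc J)))

  A-M≡U∸L+A-N : A k M ≡ (U ∸ L) + A k N
  A-M≡U∸L+A-N = begin
    A k M             ≡⟨ A-stable k (≤⇒≤′ U≤M) inE-between-U-M ⟩
    A k U             ≡⟨ A-grows k (≤⇒≤′ L≤U) inE-between-L-U ⟩
    (U ∸ L) + A k L   ≡⟨ cong ((U ∸ L) +_) (A-stable k (≤⇒≤′ N≤L) inE-between-N-L) ⟩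
    (U ∸ L) + A k N   ∎
    where
    open ≡-Reasoning
    N≤L : N ≤ L
    N≤L = /-monoˡ-≤ k (<⇒≤pred (2*10^d<10^[1+d] J))
    L≤U : L ≤ U
    L≤U = /-monoˡ-≤ k (pred-mono-≤ (m≤n*m P 2))
    U≤M : U ≤ M
    U≤M = /-monoˡ-≤ k pred[n]≤n

  U≡[pred[P]+P]/k : U ≡ (pred P + P) / k
  U≡[pred[P]+P]/k = /-congˡ (pred[2*m]≡pred[m]+m P)

  P/k≤U∸L : P / k ≤ U ∸ L
  P/k≤U∸L = begin
    P / k                ≡⟨ m+n∸m≡n L (P / k) ⟨
    L + P / k ∸ L        ≤⟨ ∸-monoˡ-≤ L (m/k+n/k≤[m+n]/k k (pred P) P) ⟩
    (pred P + P) / k ∸ L ≡⟨ cong (_∸ L) U≡[pred[P]+P]/k ⟨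
    U ∸ L                ∎
    where open ≤-Reasoning

  U∸L≤1+P/k : U ∸ L ≤ suc (P / k)
  U∸L≤1+P/k = m≤n+o⇒m∸n≤o U L
    (subst (_≤ L + suc (P / k)) (sym U≡[pred[P]+P]/k) ([m+n]/k≤m/k+[1+n/k] k (pred P) P))

module _ (k : ℕ) .{{_ : NonZero k}} where

  A-S-gap≤1+J : ∀ J → A k (2 * 10 ^ J / k) ≤ S k J + suc J × S k J ≤ A k (2 * 10 ^ J / k) + suc J
  A-S-gap≤1+J zero = A≤S+1 , S≤A+1
    where
    A≤S+1 : A k (2 / k) ≤ 1 / k + 1
    A≤S+1 = ≤-trans (A≤N k (2 / k)) (≤-trans ([1+m]/k≤1+m/k k 1) (≤-reflexive (+-comm 1 (1 / k))))
    S≤A+1 : 1 / k ≤ A k (2 / k) + 1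
    S≤A+1 = ≤-trans (m/n≤m 1 k) (m≤n+m 1 (A k (2 / k)))
  A-S-gap≤1+J (suc J) with A-S-gap≤1+J J
  ... | A≤S+1+J , S≤A+1+J = A′≤S′+2+J , S′≤A′+2+J
    where
    open Block k J
    open ≤-Reasoning
    A′≤S′+2+J : A k M ≤ P / k + S k J + suc (suc J)
    A′≤S′+2+J = begin
      A k M                              ≡⟨ A-M≡U∸L+A-N ⟩
      (U ∸ L) + A k N                    ≤⟨ +-mono-≤ U∸L≤1+P/k A≤S+1+J ⟩
      suc (P / k) + (S k J + suc J)      ≡⟨ cong suc (+-assoc (P / k) (S k J) (suc J)) ⟨
      suc (P / k + S k J + suc J)        ≡⟨ +-suc (P / k + S k J) (suc J) ⟨
      P / k + S k J + suc (suc J)        ∎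
    S′≤A′+2+J : P / k + S k J ≤ A k M + suc (suc J)
    S′≤A′+2+J = begin
      P / k + S k J                      ≤⟨ +-mono-≤ P/k≤U∸L S≤A+1+J ⟩
      (U ∸ L) + (A k N + suc J)          ≡⟨ +-assoc (U ∸ L) (A k N) (suc J) ⟨
      (U ∸ L) + A k N + suc J            ≡⟨ cong (_+ suc J) A-M≡U∸L+A-N ⟨
      A k M + suc J                      ≤⟨ +-monoʳ-≤ (A k M) (n≤1+n (suc J)) ⟩
      A k M + suc (suc J)                ∎

lemma1 : (k : ℕ) → .{{_ : NonZero k}} →
    Σ ℕ (λ C → (J : ℕ) →
      (A k ((2 * 10 ^ J) / k) ≤ S k J + C * suc J) ×
      (S k J ≤ A k ((2 * 10 ^ J) / k) + C * suc J))
lemma1 k = 1 , λ J → subst (λ c → A k (2 * 10 ^ J / k) ≤ S k J + c × S k J ≤ A k (2 * 10 ^ J / k) + c)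
  (sym (*-identityˡ (suc J))) (A-S-gap≤1+J k J)
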